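{- Let $n>1$ be an integer. Then \[P(K_n^b\cup K_2^r,\lambda)=\lambda(\lambda-1)\cdots(\lambda-n)(\lambda+n-1).\]
   Context: All graphs are finite and simple. A $2$-edge-coloured graph is a triple $G=(\Gamma,R,B)$ with $R,B\subseteq E(\Gamma)$, $R\cap B=\emptyset$, $R\cup B=E(\Gamma)$ (red and blue edges). A $k$-colouring of $G$ is a proper vertex colouring $c:V(\Gamma)\to\{1,\dots,k\}$ of $\Gamma$ such that for every $ux\in R$ and $vy\in B$ (either endpoint may play the role of $u$, resp. $v$), $c(u)=c(v)$ implies $c(x)\ne c(y)$. $P(G,\lambda)$ is the polynomial whose value at each non-negative integer $k$ is the number of $k$-colourings of $G$. $K_n^b$ is the complete graph $K_n$ with all edges blue, $K_2^r$ is a single red edge, and $\cup$ denotes disjoint union (edges keep their colours). -}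

module Defs where

open import Data.Nat using (ℕ; zero; suc; _+_; _*_; _∸_)
open import Data.Bool using (Bool; true; false; not; _∨_)
open import Data.Fin using (Fin; splitAt)
open import Data.Fin.Properties using (all?; _≟_)
open import Data.Sum using (_⊎_; inj₁; inj₂)
open import Data.Product using (_×_)
open import Data.List using (List; []; _∷_; map; concatMap; filter; length; allFin)
open import Data.Vec using (Vec; lookup) renaming ([] to []ᵛ; _∷_ to _∷ᵛ_)
open import Relation.Nullary using (Dec; ¬_; yes; no; ¬?; does)
open import Relation.Nullary.Decidable using (_×-dec_; _→-dec_)
open import Relation.Binary.PropositionalEquality using (_≡_; _≢_)
open import Data.Bool.Properties using () renaming (_≟_ to _≟ᵇ_)

-- A 2-edge-coloured graph on vertex set Fin m, given by its red and blue
-- edge relations (Bool-valued; both relations are meant to be symmetric,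
-- irreflexive and disjoint -- the concrete graphs below satisfy this).
record TwoEdgeColouredGraph (m : ℕ) : Set where
  field
    red  : Fin m → Fin m → Bool
    blue : Fin m → Fin m → Bool

open TwoEdgeColouredGraph public

_==_ : ∀ {m} → Fin m → Fin m → Bool
i == j = does (i ≟ j)

Kb : (n : ℕ) → TwoEdgeColouredGraph n
Kb n = record { red = λ _ _ → false ; blue = λ i j → not (i == j) }

K2r : TwoEdgeColouredGraph 2
K2r = record { red = λ i j → not (i == j) ; blue = λ _ _ → false }

_∪ᵍ_ : ∀ {m p} → TwoEdgeColouredGraph m → TwoEdgeColouredGraph p
     → TwoEdgeColouredGraph (m + p)
_∪ᵍ_ {m} G H = record { red = lift (red G) (red H) ; blue = lift (blue G) (blue H) }
  where
  lift : ∀ {p} → (Fin m → Fin m → Bool) → (Fin p → Fin p → Bool)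
       → Fin (m + p) → Fin (m + p) → Bool
  lift {p} r s u v with splitAt m {p} u | splitAt m {p} v
  ... | inj₁ a | inj₁ b = r a b
  ... | inj₂ a | inj₂ b = s a b
  ... | _      | _      = false

edge : ∀ {m} → TwoEdgeColouredGraph m → Fin m → Fin m → Bool
edge G u v = red G u v ∨ blue G u v

-- c is a colouring of G (with colours Fin k): proper, and for every red
-- edge ux and blue edge vy (ordered pairs, so either endpoint may play
-- the role of u resp. v), c u ≡ c v implies c x ≢ c y.
IsColouring : ∀ {m k} → TwoEdgeColouredGraph m → (Fin m → Fin k) → Set
IsColouring G c =
  (∀ u v → edge G u v ≡ true → c u ≢ c v) ×
  (∀ u x v y → red G u x ≡ true → blue G v y ≡ true → c u ≡ c v → c x ≢ c y)

isColouring? : ∀ {m k} (G : TwoEdgeColouredGraph m) (c : Fin m → Fin k)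
             → Dec (IsColouring G c)
isColouring? G c =
  all? (λ u → all? (λ v → (edge G u v ≟ᵇ true) →-dec ¬? (c u ≟ c v)))
  ×-dec
  all? (λ u → all? (λ x → all? (λ v → all? (λ y →
    (red G u x ≟ᵇ true) →-dec ((blue G v y ≟ᵇ true) →-dec
      ((c u ≟ c v) →-dec ¬? (c x ≟ c y)))))))

-- all maps Fin m → Fin k, represented as vectors (each exactly once)
allVecs : (m k : ℕ) → List (Vec (Fin k) m)
allVecs zero    k = []ᵛ ∷ []
allVecs (suc m) k = concatMap (λ i → map (i ∷ᵛ_) (allVecs m k)) (allFin k)

numColourings : ∀ {m} → TwoEdgeColouredGraph m → ℕ → ℕ
numColourings {m} G k =
  length (filter (λ v → isColouring? G (lookup v)) (allVecs m k))

-- fall k n = k (k-1) ... (k-n)   (truncated subtraction; when k ≤ n the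
-- factor k ∸ k = 0 occurs, so this agrees with the integer product)
fall : ℕ → ℕ → ℕ
fall k zero    = k
fall k (suc i) = fall k i * (k ∸ suc i)

module Submission where

-- Order the vertices as n clique vertices followed by the two ends of the red
-- edge. A map c is a colouring iff the clique gets distinct colours, the ends get
-- distinct colours, and the ends are not both coloured by clique colours: if
-- c(end₁) = c(i) and c(end₂) = c(j), then i = j breaks properness of the red edge
-- and i ≠ j makes the red edge and the blue edge ij break the colouring condition.
-- We call such maps admissible, relative to a set U of colours already in use, and
-- count them by peeling off clique vertices: the first has k - |U| choices and the
-- rest is the same problem over U plus its colour; with no clique vertex left, the
-- ordered pairs of distinct colours not both in U number (k - |U|)(k + |U| - 1).

open import Defs
open import Data.Nat using (ℕ; zero; suc; _+_; _*_; _∸_; _<_)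
open import Data.Nat.Properties
  using (+-suc; +-identityʳ; +-assoc; *-assoc; *-zeroʳ; m+n∸m≡n; +-0-monoid; +-commutativeSemigroup)
open import Data.Nat.Solver using (module +-*-Solver)
open import Data.Bool using (Bool; true; false; not; _∧_; _∨_; if_then_else_)
open import Data.Bool.Properties using (∨-identityʳ; ∨-zeroʳ; ∧-identityʳ)
open import Data.Fin using (Fin; zero; suc; _↑ˡ_; _↑ʳ_)
open import Data.Fin.Properties using (_≟_; suc-injective; splitAt-↑ˡ; splitAt-↑ʳ)
open import Data.Vec using (Vec; lookup) renaming ([] to []ᵛ; _∷_ to _∷ᵛ_)
open import Data.List using (List; []; _∷_; map; concatMap; filter; length; tabulate; _++_)
open import Data.Sum using (_⊎_; inj₁; inj₂; [_,_])
open import Data.Product using (_×_; _,_; proj₁; proj₂; ∃-syntax; swap)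
open import Function using (_∘_; _⇔_; mk⇔; Equivalence)
open import Relation.Nullary using (Dec; ¬_; yes; no; does; contradiction)
open import Relation.Unary using (Decidable)
open import Relation.Binary.PropositionalEquality
  using (_≡_; _≢_; _≗_; refl; sym; trans; cong; cong₂; module ≡-Reasoning)
open import Algebra.Properties.Monoid.Sum +-0-monoid using (sum-syntax; sum-cong-≗; sum-replicate-zero)
open import Algebra.Properties.CommutativeSemigroup +-commutativeSemigroup using (x∙yz≈y∙xz)

open Equivalence using (to; from)

==-false : ∀ {m} {i j : Fin m} → (i == j) ≡ false ⇔ i ≢ j
==-false {i = i} {j} with i ≟ j
... | yes i≡j = mk⇔ (λ ()) (λ i≢j → contradiction i≡j i≢j)
... | no  i≢j = mk⇔ (λ _ → i≢j) (λ _ → refl)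

not-true : ∀ {x} → not x ≡ true ⇔ x ≡ false
not-true {true}  = mk⇔ (λ ()) (λ ())
not-true {false} = mk⇔ (λ _ → refl) (λ _ → refl)

∧-true : ∀ {x y} → (x ∧ y) ≡ true ⇔ (x ≡ true × y ≡ true)
∧-true {true}  = mk⇔ (λ y≡true → refl , y≡true) proj₂
∧-true {false} = mk⇔ (λ ()) (λ { (() , _) })

∧-false : ∀ {x y} → (x ∧ y) ≡ false ⇔ (¬ (x ≡ true × y ≡ true))
∧-false {true}  {true}  = mk⇔ (λ ()) (λ both → contradiction (refl , refl) both)
∧-false {true}  {false} = mk⇔ (λ _ → λ { (_ , ()) }) (λ _ → refl)
∧-false {false}         = mk⇔ (λ _ → λ { (() , _) }) (λ _ → refl)

does-≡ : ∀ {P : Set} (P? : Dec P) {b} → P ⇔ (b ≡ true) → does P? ≡ b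
does-≡ (yes p)          P⇔b = sym (to P⇔b p)
does-≡ (no ¬p) {true}  P⇔b = contradiction (from P⇔b refl) ¬p
does-≡ (no ¬p) {false} _   = refl

count : {A : Set} → (A → Bool) → List A → ℕ
count f []       = 0
count f (x ∷ xs) = if f x then suc (count f xs) else count f xs

length-filter≡count : ∀ {A : Set} {P : A → Set} (P? : Decidable P) (xs : List A)
                    → length (filter P? xs) ≡ count (does ∘ P?) xs
length-filter≡count P? []       = refl
length-filter≡count P? (x ∷ xs) with does (P? x)
... | true  = cong suc (length-filter≡count P? xs)
... | false = length-filter≡count P? xs

count-cong : ∀ {A : Set} {f g : A → Bool} → f ≗ g → count f ≗ count g
count-cong f≗g []       = refl
count-cong {g = g} f≗g (x ∷ xs) rewrite f≗g x with g x
... | true  = cong suc (count-cong f≗g xs)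
... | false = count-cong f≗g xs

count-false : ∀ {A : Set} (xs : List A) → count (λ _ → false) xs ≡ 0
count-false []       = refl
count-false (x ∷ xs) = count-false xs

count-++ : ∀ {A : Set} (f : A → Bool) (xs ys : List A)
         → count f (xs ++ ys) ≡ count f xs + count f ys
count-++ f []       ys = refl
count-++ f (x ∷ xs) ys with f x
... | true  = cong suc (count-++ f xs ys)
... | false = count-++ f xs ys

count-map : ∀ {A B : Set} (f : A → Bool) (h : B → A) (ys : List B)
          → count f (map h ys) ≡ count (f ∘ h) ys
count-map f h []       = refl
count-map f h (y ∷ ys) with f (h y)
... | true  = cong suc (count-map f h ys)
... | false = count-map f h ys

count-concatMap : ∀ {A B : Set} (f : A → Bool) {k} (h : Fin k → B) (g : B → List A)
                → count f (concatMap g (tabulate h)) ≡ ∑[ i < k ] count f (g (h i))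
count-concatMap f {zero}  h g = refl
count-concatMap f {suc k} h g = begin
  count f (g (h zero) ++ concatMap g (tabulate (h ∘ suc)))
    ≡⟨ count-++ f (g (h zero)) _ ⟩
  count f (g (h zero)) + count f (concatMap g (tabulate (h ∘ suc)))
    ≡⟨ cong (count f (g (h zero)) +_) (count-concatMap f (h ∘ suc) g) ⟩
  count f (g (h zero)) + ∑[ i < k ] count f (g (h (suc i)))  ∎
  where open ≡-Reasoning

count-allVecs-suc : ∀ m k (f : Vec (Fin k) (suc m) → Bool)
                  → count f (allVecs (suc m) k) ≡ ∑[ i < k ] count (f ∘ (i ∷ᵛ_)) (allVecs m k)
count-allVecs-suc m k f =
  trans (count-concatMap f (λ i → i) (λ i → map (i ∷ᵛ_) (allVecs m k)))
        (sum-cong-≗ (λ i → count-map f (i ∷ᵛ_) (allVecs m k)))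

indicator : Bool → ℕ
indicator b = if b then 1 else 0

size : ∀ {k} → (Fin k → Bool) → ℕ
size {k} U = ∑[ i < k ] indicator (U i)

∅ : ∀ {k} → Fin k → Bool
∅ _ = false

size-∅ : ∀ k → size (∅ {k}) ≡ 0
size-∅ k = sum-replicate-zero k

size-complement : ∀ k (U : Fin k → Bool) → size U + size (not ∘ U) ≡ k
size-complement zero    U = refl
size-complement (suc k) U with U zero
... | true  = cong suc (size-complement k (U ∘ suc))
... | false = trans (+-suc (size (U ∘ suc)) _) (cong suc (size-complement k (U ∘ suc)))

size-not : ∀ k (U : Fin k → Bool) → size (not ∘ U) ≡ k ∸ size U
size-not k U = trans (sym (m+n∸m≡n (size U) _)) (cong (_∸ size U) (size-complement k U))

sum-if : ∀ k (U : Fin k → Bool) (p q : ℕ)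
       → ∑[ i < k ] (if U i then p else q) ≡ size U * p + size (not ∘ U) * q
sum-if zero    U p q = refl
sum-if (suc k) U p q with U zero
... | true  = trans (cong (p +_) (sum-if k (U ∘ suc) p q)) (sym (+-assoc p _ _))
... | false = trans (cong (q +_) (sum-if k (U ∘ suc) p q))
                    (x∙yz≈y∙xz q (size (U ∘ suc) * p) (size (not ∘ U ∘ suc) * q))

_⊕_ : ∀ {k} → (Fin k → Bool) → Fin k → Fin k → Bool
(U ⊕ x) z = U z ∨ (x == z)

⊕-true : ∀ {k} (U : Fin k → Bool) x {z} → (U ⊕ x) z ≡ true ⇔ (U z ≡ true ⊎ x ≡ z)
⊕-true U x {z} with U z | x ≟ z
... | true  | _       = mk⇔ (λ _ → inj₁ refl) (λ _ → refl)
... | false | yes x≡z = mk⇔ (λ _ → inj₂ x≡z) (λ _ → refl)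
... | false | no  x≢z = mk⇔ (λ ()) [ (λ ()) , (λ x≡z → contradiction x≡z x≢z) ]

⊕-false : ∀ {k} (U : Fin k → Bool) x {z} → (U ⊕ x) z ≡ false ⇔ (U z ≡ false × x ≢ z)
⊕-false U x {z} with U z | x ≟ z
... | true  | _       = mk⇔ (λ ()) (λ { (() , _) })
... | false | yes x≡z = mk⇔ (λ ()) (λ { (_ , x≢z) → contradiction x≡z x≢z })
... | false | no  x≢z = mk⇔ (λ _ → refl , x≢z) (λ _ → refl)

size-⊕ : ∀ k (U : Fin k → Bool) x → U x ≡ false → size (U ⊕ x) ≡ suc (size U)
size-⊕ (suc k) U zero    Ux≡false rewrite Ux≡false =
  cong suc (sum-cong-≗ (λ i → cong indicator (∨-identityʳ (U (suc i)))))
size-⊕ (suc k) U (suc x) Ux≡false rewrite ∨-identityʳ (U zero) =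
  trans (cong (indicator (U zero) +_) (size-⊕ k (U ∘ suc) x Ux≡false))
        (+-suc (indicator (U zero)) _)

fallFrom : ℕ → ℕ → ℕ → ℕ
fallFrom k s zero    = k ∸ s
fallFrom k s (suc m) = (k ∸ s) * fallFrom k (suc s) m

fallFrom-suc : ∀ k s m → fallFrom k s (suc m) ≡ fallFrom k s m * (k ∸ (s + suc m))
fallFrom-suc k s zero    rewrite +-suc s 0 | +-identityʳ s = refl
fallFrom-suc k s (suc m) rewrite fallFrom-suc k (suc s) m | +-suc s (suc m) =
  sym (*-assoc (k ∸ s) (fallFrom k (suc s) m) _)

fall≡fallFrom : ∀ k n → fall k n ≡ fallFrom k 0 n
fall≡fallFrom k zero    = refl
fall≡fallFrom k (suc n) = trans (cong (_* (k ∸ suc n)) (fall≡fallFrom k n)) (sym (fallFrom-suc k 0 n))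

-- With k = s + r colours of which s are taken: ordered pairs of distinct colours
-- not both taken number s·r + r·(k − 1) = (k − s)(k + s − 1).
pairs-arith : ∀ s r → s * r + r * (s + r ∸ 1) ≡ (s + r ∸ s) * (s + r + (s + 0) ∸ 1)
pairs-arith s r rewrite m+n∸m≡n s r | +-identityʳ s with r
... | zero  = trans (+-identityʳ (s * 0)) (*-zeroʳ s)
... | suc r rewrite +-suc s r =
  solve 2 (λ s r → s :* (con 1 :+ r) :+ (con 1 :+ r) :* (s :+ r)
                := (con 1 :+ r) :* (s :+ r :+ s)) refl s r
  where open +-*-Solver

clique : ∀ {m} → Fin m → Fin (m + 2)
clique i = i ↑ˡ 2

endA endB : ∀ {m} → Fin (m + 2)
endA {m} = m ↑ʳ zero
endB {m} = m ↑ʳ suc zero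

Taken : ∀ {m k} → (Fin k → Bool) → (Fin (m + 2) → Fin k) → Fin k → Set
Taken {m} U c y = U y ≡ true ⊎ ∃[ i ] y ≡ c (clique {m} i)

record Admissible {k} (m : ℕ) (U : Fin k → Bool) (c : Fin (m + 2) → Fin k) : Set where
  field
    fresh               : ∀ i → U (c (clique i)) ≡ false
    distinct            : ∀ i j → i ≢ j → c (clique i) ≢ c (clique j)
    ends-distinct       : c endA ≢ c endB
    ends-not-both-taken : ¬ (Taken U c (c endA) × Taken U c (c endB))

taken-cons : ∀ {m k} (U : Fin k → Bool) (c : Fin (suc m + 2) → Fin k) {y}
           → Taken U c y ⇔ Taken (U ⊕ c zero) (c ∘ suc) y
taken-cons U c = mk⇔ forward backward
  where
  forward : ∀ {y} → Taken U c y → Taken (U ⊕ c zero) (c ∘ suc) y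
  forward (inj₁ Uy)              = inj₁ (from (⊕-true U (c zero)) (inj₁ Uy))
  forward (inj₂ (zero  , y≡c₀))  = inj₁ (from (⊕-true U (c zero)) (inj₂ (sym y≡c₀)))
  forward (inj₂ (suc i , y≡cᵢ))  = inj₂ (i , y≡cᵢ)
  backward : ∀ {y} → Taken (U ⊕ c zero) (c ∘ suc) y → Taken U c y
  backward (inj₁ y∈U⊕c₀) = [ inj₁ , (λ c₀≡y → inj₂ (zero , sym c₀≡y)) ] (to (⊕-true U (c zero)) y∈U⊕c₀)
  backward (inj₂ (i , y≡cᵢ)) = inj₂ (suc i , y≡cᵢ)

admissible-uncons : ∀ {m k} (U : Fin k → Bool) (c : Fin (suc m + 2) → Fin k)
                  → Admissible (suc m) U c → U (c zero) ≡ false × Admissible m (U ⊕ c zero) (c ∘ suc)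
admissible-uncons U c A = fresh zero , record
  { fresh               = λ i → from (⊕-false U (c zero)) (fresh (suc i) , distinct zero (suc i) (λ ()))
  ; distinct            = λ i j i≢j → distinct (suc i) (suc j) (i≢j ∘ suc-injective)
  ; ends-distinct       = ends-distinct
  ; ends-not-both-taken = λ { (a , b) → ends-not-both-taken (from taken-c a , from taken-c b) }
  }
  where
  open Admissible A
  taken-c = taken-cons U c

admissible-cons : ∀ {m k} (U : Fin k → Bool) (c : Fin (suc m + 2) → Fin k)
                → U (c zero) ≡ false → Admissible m (U ⊕ c zero) (c ∘ suc) → Admissible (suc m) U c
admissible-cons U c c₀∉U A = record
  { fresh               = fresh′
  ; distinct            = distinct′
  ; ends-distinct       = ends-distinct
  ; ends-not-both-taken = λ { (a , b) → ends-not-both-taken (to taken-c a , to taken-c b) }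
  }
  where
  open Admissible A
  taken-c = taken-cons U c
  fresh′ : ∀ i → U (c (clique i)) ≡ false
  fresh′ zero    = c₀∉U
  fresh′ (suc i) = proj₁ (to (⊕-false U (c zero)) (fresh i))
  distinct′ : ∀ i j → i ≢ j → c (clique i) ≢ c (clique j)
  distinct′ zero    zero    i≢j = contradiction refl i≢j
  distinct′ zero    (suc j) _   = proj₂ (to (⊕-false U (c zero)) (fresh j))
  distinct′ (suc i) zero    _   = proj₂ (to (⊕-false U (c zero)) (fresh i)) ∘ sym
  distinct′ (suc i) (suc j) i≢j = distinct i j (i≢j ∘ cong suc)

ends-distinct-any : ∀ {m k} {U : Fin k → Bool} {c : Fin (m + 2) → Fin k} → Admissible m U c
                  → ∀ a b → a ≢ b → c (m ↑ʳ a) ≢ c (m ↑ʳ b)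
ends-distinct-any A zero       zero       a≢b = contradiction refl a≢b
ends-distinct-any A zero       (suc zero) _   = Admissible.ends-distinct A
ends-distinct-any A (suc zero) zero       _   = Admissible.ends-distinct A ∘ sym
ends-distinct-any A (suc zero) (suc zero) a≢b = contradiction refl a≢b

ends-not-both-taken-any : ∀ {m k} {U : Fin k → Bool} {c : Fin (m + 2) → Fin k} → Admissible m U c
                        → ∀ a b → a ≢ b → ¬ (Taken U c (c (m ↑ʳ a)) × Taken U c (c (m ↑ʳ b)))
ends-not-both-taken-any A zero       zero       a≢b = contradiction refl a≢b
ends-not-both-taken-any A zero       (suc zero) _   = Admissible.ends-not-both-taken A
ends-not-both-taken-any A (suc zero) zero       _   = Admissible.ends-not-both-taken A ∘ swap
ends-not-both-taken-any A (suc zero) (suc zero) a≢b = contradiction refl a≢b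

admissibleᵇ : ∀ m {k} → (Fin k → Bool) → Vec (Fin k) (m + 2) → Bool
admissibleᵇ zero    U (a ∷ᵛ b ∷ᵛ []ᵛ) = not (a == b) ∧ not (U a ∧ U b)
admissibleᵇ (suc m) U (x ∷ᵛ w)       = not (U x) ∧ admissibleᵇ m (U ⊕ x) w

admissibleᵇ-sound : ∀ m {k} (U : Fin k → Bool) v → admissibleᵇ m U v ≡ true → Admissible m U (lookup v)
admissibleᵇ-sound zero U (a ∷ᵛ b ∷ᵛ []ᵛ) ok = record
  { fresh               = λ ()
  ; distinct            = λ ()
  ; ends-distinct       = to ==-false (to not-true differ)
  ; ends-not-both-taken = λ { (inj₁ Ua , inj₁ Ub) → to ∧-false (to not-true notBoth) (Ua , Ub)
                            ; (inj₂ (() , _) , _)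
                            ; (inj₁ _ , inj₂ (() , _)) }
  }
  where
  differ  = proj₁ (to ∧-true ok)
  notBoth = proj₂ (to ∧-true ok)
admissibleᵇ-sound (suc m) U (x ∷ᵛ w) ok =
  admissible-cons U (lookup (x ∷ᵛ w)) (to not-true (proj₁ (to ∧-true ok)))
    (admissibleᵇ-sound m (U ⊕ x) w (proj₂ (to ∧-true ok)))

admissibleᵇ-complete : ∀ m {k} (U : Fin k → Bool) v → Admissible m U (lookup v) → admissibleᵇ m U v ≡ true
admissibleᵇ-complete zero U (a ∷ᵛ b ∷ᵛ []ᵛ) A =
  from ∧-true ( from not-true (from ==-false ends-distinct)
              , from not-true (from ∧-false (λ { (Ua , Ub) → ends-not-both-taken (inj₁ Ua , inj₁ Ub) })))
  where open Admissible A
admissibleᵇ-complete (suc m) U (x ∷ᵛ w) A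
  with x∉U , A′ ← admissible-uncons U (lookup (x ∷ᵛ w)) A =
  from ∧-true (from not-true x∉U , admissibleᵇ-complete m (U ⊕ x) w A′)

partners : ∀ k (U : Fin k → Bool) a
         → ∑[ b < k ] indicator (not (a == b) ∧ not (U a ∧ U b)) ≡ (if U a then size (not ∘ U) else k ∸ 1)
partners k U a with U a in Ua
... | true = sum-cong-≗ same
  where
  same : ∀ b → indicator (not (a == b) ∧ not (U b)) ≡ indicator (not (U b))
  same b with a ≟ b
  ... | yes refl rewrite Ua = refl
  ... | no  _               = refl
... | false = begin
  ∑[ b < k ] indicator (not (a == b) ∧ true) ≡⟨ sum-cong-≗ (λ b → cong indicator (∧-identityʳ (not (a == b)))) ⟩
  size (not ∘ (∅ ⊕ a))                      ≡⟨ size-not k (∅ ⊕ a) ⟩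
  k ∸ size (∅ ⊕ a)                           ≡⟨ cong (k ∸_) (trans (size-⊕ k ∅ a refl) (cong suc (size-∅ k))) ⟩
  k ∸ 1                                      ∎
  where open ≡-Reasoning

count-admissible : ∀ m k (U : Fin k → Bool) s → size U ≡ s
                 → count (admissibleᵇ m U) (allVecs (m + 2) k) ≡ fallFrom k s m * (k + (s + m) ∸ 1)
count-admissible zero k U .(size U) refl = begin
  count (admissibleᵇ 0 U) (allVecs 2 k)
    ≡⟨ count-allVecs-suc 1 k (admissibleᵇ 0 U) ⟩
  ∑[ a < k ] count (admissibleᵇ 0 U ∘ (a ∷ᵛ_)) (allVecs 1 k)
    ≡⟨ sum-cong-≗ (λ a → trans (count-allVecs-suc 0 k _) (partners k U a)) ⟩
  ∑[ a < k ] (if U a then r else k ∸ 1)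
    ≡⟨ sum-if k U r (k ∸ 1) ⟩
  size U * r + r * (k ∸ 1)
    ≡⟨ complement-pairs (size-complement k U) ⟩
  (k ∸ size U) * (k + (size U + 0) ∸ 1) ∎
  where
  open ≡-Reasoning
  r = size (not ∘ U)
  complement-pairs : ∀ {s k} → s + r ≡ k → s * r + r * (k ∸ 1) ≡ (k ∸ s) * (k + (s + 0) ∸ 1)
  complement-pairs {s} refl = pairs-arith s r
count-admissible (suc m) k U .(size U) refl = begin
  count (admissibleᵇ (suc m) U) (allVecs (suc m + 2) k)
    ≡⟨ count-allVecs-suc (m + 2) k (admissibleᵇ (suc m) U) ⟩
  ∑[ x < k ] count (admissibleᵇ (suc m) U ∘ (x ∷ᵛ_)) (allVecs (m + 2) k)
    ≡⟨ sum-cong-≗ extend ⟩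
  ∑[ x < k ] (if U x then 0 else rest)
    ≡⟨ sum-if k U 0 rest ⟩
  size U * 0 + size (not ∘ U) * rest
    ≡⟨ cong₂ (λ z r → z + r * rest) (*-zeroʳ (size U)) (size-not k U) ⟩
  (k ∸ size U) * rest
    ≡⟨ *-assoc (k ∸ size U) (fallFrom k (suc (size U)) m) _ ⟨
  fallFrom k (size U) (suc m) * (k + suc (size U + m) ∸ 1)
    ≡⟨ cong (λ t → fallFrom k (size U) (suc m) * (k + t ∸ 1)) (+-suc (size U) m) ⟨
  fallFrom k (size U) (suc m) * (k + (size U + suc m) ∸ 1) ∎
  where
  open ≡-Reasoning
  rest = fallFrom k (suc (size U)) m * (k + (suc (size U) + m) ∸ 1)
  -- the first clique colour x must avoid U; the rest is the same problem over U ⊕ x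
  extend : ∀ x → count (admissibleᵇ (suc m) U ∘ (x ∷ᵛ_)) (allVecs (m + 2) k) ≡ (if U x then 0 else rest)
  extend x with U x in Ux
  ... | true  = count-false (allVecs (m + 2) k)
  ... | false = count-admissible m k (U ⊕ x) (suc (size U)) (size-⊕ k U x Ux)

data Side (m p : ℕ) : Fin (m + p) → Set where
  left  : (i : Fin m) → Side m p (i ↑ˡ p)
  right : (j : Fin p) → Side m p (m ↑ʳ j)

side : ∀ m {p} (u : Fin (m + p)) → Side m p u
side zero    u       = right u
side (suc m) zero    = left zero
side (suc m) (suc u) with side m u
... | left  i = left (suc i)
... | right j = right j

∪-left : ∀ {m p} (G : TwoEdgeColouredGraph m) (H : TwoEdgeColouredGraph p) (i j : Fin m)
       → red (G ∪ᵍ H) (i ↑ˡ p) (j ↑ˡ p) ≡ red G i j × blue (G ∪ᵍ H) (i ↑ˡ p) (j ↑ˡ p) ≡ blue G i j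
∪-left {m} {p} G H i j rewrite splitAt-↑ˡ m i p | splitAt-↑ˡ m j p = refl , refl

∪-right : ∀ {m p} (G : TwoEdgeColouredGraph m) (H : TwoEdgeColouredGraph p) (i j : Fin p)
        → red (G ∪ᵍ H) (m ↑ʳ i) (m ↑ʳ j) ≡ red H i j × blue (G ∪ᵍ H) (m ↑ʳ i) (m ↑ʳ j) ≡ blue H i j
∪-right {m} {p} G H i j rewrite splitAt-↑ʳ m p i | splitAt-↑ʳ m p j = refl , refl

∪-across : ∀ {m p} (G : TwoEdgeColouredGraph m) (H : TwoEdgeColouredGraph p) (i : Fin m) (j : Fin p)
         → red (G ∪ᵍ H) (i ↑ˡ p) (m ↑ʳ j) ≡ false × blue (G ∪ᵍ H) (i ↑ˡ p) (m ↑ʳ j) ≡ false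
∪-across {m} {p} G H i j rewrite splitAt-↑ˡ m i p | splitAt-↑ʳ m p j = refl , refl

∪-across′ : ∀ {m p} (G : TwoEdgeColouredGraph m) (H : TwoEdgeColouredGraph p) (i : Fin m) (j : Fin p)
          → red (G ∪ᵍ H) (m ↑ʳ j) (i ↑ˡ p) ≡ false × blue (G ∪ᵍ H) (m ↑ʳ j) (i ↑ˡ p) ≡ false
∪-across′ {m} {p} G H i j rewrite splitAt-↑ˡ m i p | splitAt-↑ʳ m p j = refl , refl

red⇒edge : ∀ {m} (G : TwoEdgeColouredGraph m) {u v} → red G u v ≡ true → edge G u v ≡ true
red⇒edge G uv rewrite uv = refl

blue⇒edge : ∀ {m} (G : TwoEdgeColouredGraph m) {u v} → blue G u v ≡ true → edge G u v ≡ true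
blue⇒edge G {u} {v} uv rewrite uv = ∨-zeroʳ (red G u v)

edge⇒red⊎blue : ∀ {m} (G : TwoEdgeColouredGraph m) {u v} → edge G u v ≡ true
              → red G u v ≡ true ⊎ blue G u v ≡ true
edge⇒red⊎blue G {u} {v} uv with red G u v
... | true  = inj₁ refl
... | false = inj₂ uv

module CliqueAndRedEdge (n : ℕ) where

  G : TwoEdgeColouredGraph (n + 2)
  G = Kb n ∪ᵍ K2r

  red-edge : ∀ u x → red G u x ≡ true → ∃[ a ] ∃[ b ] u ≡ n ↑ʳ a × x ≡ n ↑ʳ b × a ≢ b
  red-edge u x ux with side n u | side n x
  ... | left i  | left j  = contradiction (trans (sym (proj₁ (∪-left (Kb n) K2r i j))) ux) λ ()
  ... | left i  | right j = contradiction (trans (sym (proj₁ (∪-across (Kb n) K2r i j))) ux) λ ()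
  ... | right j | left i  = contradiction (trans (sym (proj₁ (∪-across′ (Kb n) K2r i j))) ux) λ ()
  ... | right a | right b =
    a , b , refl , refl , to ==-false (to not-true (trans (sym (proj₁ (∪-right (Kb n) K2r a b))) ux))

  blue-edge : ∀ v y → blue G v y ≡ true → ∃[ i ] ∃[ j ] v ≡ clique i × y ≡ clique j × i ≢ j
  blue-edge v y vy with side n v | side n y
  ... | left i  | left j  =
    i , j , refl , refl , to ==-false (to not-true (trans (sym (proj₂ (∪-left (Kb n) K2r i j))) vy))
  ... | left i  | right j = contradiction (trans (sym (proj₂ (∪-across (Kb n) K2r i j))) vy) λ ()
  ... | right j | left i  = contradiction (trans (sym (proj₂ (∪-across′ (Kb n) K2r i j))) vy) λ ()
  ... | right a | right b = contradiction (trans (sym (proj₂ (∪-right (Kb n) K2r a b))) vy) λ ()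

  red-ends : red G endA endB ≡ true
  red-ends = proj₁ (∪-right (Kb n) K2r zero (suc zero))

  blue-clique : ∀ {i j} → i ≢ j → blue G (clique i) (clique j) ≡ true
  blue-clique {i} {j} i≢j = trans (proj₂ (∪-left (Kb n) K2r i j)) (from not-true (from ==-false i≢j))

  -- Colourings are admissible: the red edge forces distinct end colours, and two
  -- clique colours on the ends would give a red and a blue edge coloured alike.
  colouring⇒admissible : ∀ {k} (c : Fin (n + 2) → Fin k) → IsColouring G c → Admissible n ∅ c
  colouring⇒admissible c (proper , red-blue) = record
    { fresh               = λ _ → refl
    ; distinct            = λ i j i≢j → proper (clique i) (clique j) (blue⇒edge G (blue-clique i≢j))
    ; ends-distinct       = ends-distinct
    ; ends-not-both-taken = not-both
    }
    where
    ends-distinct : c endA ≢ c endB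
    ends-distinct = proper endA endB (red⇒edge G red-ends)
    -- no colour lies in ∅, so only clique colours can be taken
    not-both : ¬ (Taken ∅ c (c endA) × Taken ∅ c (c endB))
    not-both (inj₂ (i , a≡cᵢ) , inj₂ (j , b≡cⱼ)) with i ≟ j
    ... | yes refl = ends-distinct (trans a≡cᵢ (sym b≡cⱼ))
    ... | no  i≢j  = red-blue endA endB (clique i) (clique j) red-ends (blue-clique i≢j) a≡cᵢ b≡cⱼ

  admissible⇒colouring : ∀ {k} (c : Fin (n + 2) → Fin k) → Admissible n ∅ c → IsColouring G c
  admissible⇒colouring c A = proper , red-blue
    where
    open Admissible A
    proper : ∀ u v → edge G u v ≡ true → c u ≢ c v
    proper u v uv with edge⇒red⊎blue G uv
    ... | inj₁ red-uv  with a , b , refl , refl , a≢b ← red-edge u v red-uv   = ends-distinct-any A a b a≢b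
    ... | inj₂ blue-uv with i , j , refl , refl , i≢j ← blue-edge u v blue-uv = distinct i j i≢j
    red-blue : ∀ u x v y → red G u x ≡ true → blue G v y ≡ true → c u ≡ c v → c x ≢ c y
    red-blue u x v y red-ux blue-vy cu≡cv cx≡cy
      with a , b , refl , refl , a≢b ← red-edge u x red-ux
         | i , j , refl , refl , _   ← blue-edge v y blue-vy
      = ends-not-both-taken-any A a b a≢b (inj₂ (i , cu≡cv) , inj₂ (j , cx≡cy))

  colouring-test : ∀ {k} (v : Vec (Fin k) (n + 2)) → does (isColouring? G (lookup v)) ≡ admissibleᵇ n ∅ v
  colouring-test v = does-≡ (isColouring? G (lookup v)) (mk⇔
    (admissibleᵇ-complete n ∅ v ∘ colouring⇒admissible (lookup v))
    (admissible⇒colouring (lookup v) ∘ admissibleᵇ-sound n ∅ v))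

-- The count holds for every n.
corollary15 : (n : ℕ) → 1 < n → (k : ℕ)
    → numColourings (Kb n ∪ᵍ K2r) k ≡ fall k n * (k + n ∸ 1)
corollary15 n _ k = begin
  numColourings G k
    ≡⟨ length-filter≡count (λ v → isColouring? G (lookup v)) (allVecs (n + 2) k) ⟩
  count (λ v → does (isColouring? G (lookup v))) (allVecs (n + 2) k)
    ≡⟨ count-cong colouring-test (allVecs (n + 2) k) ⟩
  count (admissibleᵇ n ∅) (allVecs (n + 2) k)
    ≡⟨ count-admissible n k ∅ 0 (size-∅ k) ⟩
  fallFrom k 0 n * (k + n ∸ 1)
    ≡⟨ cong (_* (k + n ∸ 1)) (fall≡fallFrom k n) ⟨
  fall k n * (k + n ∸ 1) ∎
  where
  open ≡-Reasoning
  open CliqueAndRedEdge n
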